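{- Let $\mathbf L=(L,\vee,\wedge,{}^*,0,1)$ be a complete pseudocomplemented lattice. Then $\mathrm{Cl}(\mathbf L)=\{x^\perp\mid x\in L\}$.
   Context: A bounded lattice is pseudocomplemented if each $x$ has a greatest $x^*$ with $x\wedge x^*=0$. The orthogonality relation is $x\perp y$ iff $x\wedge y=0$ (equivalently $y\le x^*$). For $A\subseteq L$, $A^\perp:=\{x\in L\mid x\perp y\text{ for all }y\in A\}$, $x^\perp:=\{x\}^\perp$. $A$ is closed if $A^{\perp\perp}=A$, and $\mathrm{Cl}(\mathbf L)$ is the set of all closed subsets of $L$. -}

module Defs where

open import Level using (Level; _⊔_; suc)
open import Data.Product using (Σ; _×_; ∃)
open import Relation.Unary using (Pred; _∈_; _≐_; ｛_｝)
open import Relation.Binary.Lattice.Bundles using (BoundedLattice)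

module _ {c ℓ₁ ℓ₂ : Level} (L : BoundedLattice c ℓ₁ ℓ₂) where
  open BoundedLattice L

  IsUpperBound : {ℓ : Level} → Pred Carrier ℓ → Carrier → Set _
  IsUpperBound S s = ∀ y → y ∈ S → y ≤ s

  IsLowerBound : {ℓ : Level} → Pred Carrier ℓ → Carrier → Set _
  IsLowerBound S s = ∀ y → y ∈ S → s ≤ y

  IsSupremum : {ℓ : Level} → Pred Carrier ℓ → Carrier → Set _
  IsSupremum S s = IsUpperBound S s × (∀ u → IsUpperBound S u → s ≤ u)

  IsInfimum : {ℓ : Level} → Pred Carrier ℓ → Carrier → Set _
  IsInfimum S s = IsLowerBound S s × (∀ u → IsLowerBound S u → u ≤ s)

  IsComplete : (ℓ : Level) → Set _
  IsComplete ℓ = (S : Pred Carrier ℓ) → ∃ (IsSupremum S) × ∃ (IsInfimum S)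

  IsPseudocomplement : (Carrier → Carrier) → Set _
  IsPseudocomplement _* = ∀ x → (x ∧ (x *)) ≈ ⊥ × (∀ y → (x ∧ y) ≈ ⊥ → y ≤ (x *))

  _⊥′_ : Carrier → Carrier → Set ℓ₁
  x ⊥′ y = (x ∧ y) ≈ ⊥

  perp : {ℓ : Level} → Pred Carrier ℓ → Pred Carrier (c ⊔ ℓ₁ ⊔ ℓ)
  perp A x = ∀ y → y ∈ A → x ⊥′ y

  perp₁ : Carrier → Pred Carrier (c ⊔ ℓ₁)
  perp₁ x = perp ｛ x ｝

  IsClosed : {ℓ : Level} → Pred Carrier ℓ → Set _
  IsClosed A = perp (perp A) ≐ A

-- Pseudocomplementation turns orthogonality into an order condition: x ⊥ y iff y ≤ x*.
-- Hence y ⊥ s for s = ⋁ S exactly when every element of S lies below y*, i.e. s^⊥ = S^⊥.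
-- For closed A, taking S = A^⊥ gives A = A^⊥⊥ = s^⊥. Conversely every x^⊥ = {x}^⊥ is
-- closed, since A^⊥⊥⊥ = A^⊥ holds for the polarity of any symmetric relation.
module Submission where

open import Defs
open import Level using (Level; _⊔_)
open import Data.Product using (∃; _,_)
open import Relation.Unary using (Pred; _⊆_; _≐_)
open import Relation.Unary.Properties using (≐-sym; ≐-trans)
open import Relation.Binary.Definitions using (Symmetric)
open import Relation.Binary.PropositionalEquality using (refl)
open import Function.Bundles using (_⇔_; mk⇔)
open import Relation.Binary.Lattice.Bundles using (BoundedLattice)
import Relation.Binary.Lattice.Properties.MeetSemilattice as MeetSemilatticeProperties

module Orthogonality {c ℓ₁ ℓ₂ : Level} (L : BoundedLattice c ℓ₁ ℓ₂) where
  open BoundedLattice L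
  open MeetSemilatticeProperties meetSemilattice using (∧-comm)

  private
    variable
      ℓ ℓ′ : Level
      A : Pred Carrier ℓ
      B : Pred Carrier ℓ′

  ⊥′-sym : Symmetric (_⊥′_ L)
  ⊥′-sym {x} {y} x⊥y = Eq.trans (∧-comm y x) x⊥y

  perp-antitone : A ⊆ B → perp L B ⊆ perp L A
  perp-antitone A⊆B x⊥B y y∈A = x⊥B y (A⊆B y∈A)

  perp-cong : A ≐ B → perp L A ≐ perp L B
  perp-cong (A⊆B , B⊆A) = perp-antitone B⊆A , perp-antitone A⊆B

  ⊆-perp-perp : A ⊆ perp L (perp L A)
  ⊆-perp-perp x∈A y y⊥A = ⊥′-sym (y⊥A _ x∈A)

  perp-isClosed : IsClosed L (perp L A)
  perp-isClosed = perp-antitone ⊆-perp-perp , ⊆-perp-perp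

  isClosed-resp-≐ : A ≐ B → IsClosed L B → IsClosed L A
  isClosed-resp-≐ A≐B B-closed =
    ≐-trans (perp-cong (perp-cong A≐B)) (≐-trans B-closed (≐-sym A≐B))

  perp₁-isClosed : ∀ x → IsClosed L (perp₁ L x)
  perp₁-isClosed x = perp-isClosed

module Pseudocomplemented {c ℓ₁ ℓ₂ : Level} (L : BoundedLattice c ℓ₁ ℓ₂)
  (_* : BoundedLattice.Carrier L → BoundedLattice.Carrier L) (pc : IsPseudocomplement L _*) where
  open BoundedLattice L renaming (refl to ≤-refl)
  open MeetSemilatticeProperties meetSemilattice using (∧-monotonic)

  ⊥′⇒≤* : ∀ {x y} → _⊥′_ L x y → y ≤ x *
  ⊥′⇒≤* {x} {y} x⊥y = let (_ , greatest) = pc x in greatest y x⊥y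

  ≤*⇒⊥′ : ∀ {x y} → y ≤ x * → _⊥′_ L x y
  ≤*⇒⊥′ {x} y≤x* = let (x∧x*≈⊥ , _) = pc x in
    antisym (trans (∧-monotonic ≤-refl y≤x*) (reflexive x∧x*≈⊥)) (minimum _)

  perp₁-supremum : ∀ {ℓ} {S : Pred Carrier ℓ} {s} → IsSupremum L S s → perp₁ L s ≐ perp L S
  perp₁-supremum (upper , least) =
    (λ y⊥s z z∈S → ≤*⇒⊥′ (trans (upper z z∈S) (⊥′⇒≤* (y⊥s _ refl))))
    , λ { y⊥S _ refl → ≤*⇒⊥′ (least _ λ z z∈S → ⊥′⇒≤* (y⊥S z z∈S)) }

corollary3 : {c ℓ₁ ℓ₂ : Level} (L : BoundedLattice c ℓ₁ ℓ₂)
    → IsComplete L (c ⊔ ℓ₁ ⊔ ℓ₂)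
    → (_* : BoundedLattice.Carrier L → BoundedLattice.Carrier L)
    → IsPseudocomplement L _*
    → (A : Pred (BoundedLattice.Carrier L) (c ⊔ ℓ₁ ⊔ ℓ₂))
    → IsClosed L A ⇔ ∃ (λ x → A ≐ perp₁ L x)
corollary3 L complete _* pc A = mk⇔ closed⇒perp₁ perp₁⇒closed
  where
  open Orthogonality L
  open Pseudocomplemented L _* pc

  closed⇒perp₁ : IsClosed L A → ∃ (λ x → A ≐ perp₁ L x)
  closed⇒perp₁ A-closed =
    let ((s , s-sup) , _) = complete (perp L A)
    in s , ≐-trans (≐-sym A-closed) (≐-sym (perp₁-supremum s-sup))

  perp₁⇒closed : ∃ (λ x → A ≐ perp₁ L x) → IsClosed L A
  perp₁⇒closed (x , A≐x⊥) = isClosed-resp-≐ A≐x⊥ (perp₁-isClosed x)
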